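{- Let $n\ge 3$ and $d<n$, and let $F:\{0,1\}^n\to\{0,1\}^n$ be a bijective automata network of degree at most $d$ which is centralized. Then $F$ has an even number of limit cycles.
   Context: An automata network is a map $F:\{0,1\}^V\to\{0,1\}^V$, $V=\{1,\dots,n\}$, with local functions $f_j(x)=F(x)_j$. Its interaction graph $G(F)$ has an arc $(i,j)$ iff $f_j$ effectively depends on $x_i$ (there exist $x,x'$ differing only at $i$ with $f_j(x)\neq f_j(x')$). The degree of $F$ is the maximum in-degree of $G(F)$. $F$ is centralized if $G(F)$ has a node whose deletion leaves the graph acyclic. For a bijection, the limit cycles are the cycles of the permutation $F$ (fixed points count as cycles of length $1$). -}

module Defs where

open import Data.Bool using (Bool)
open import Data.Nat using (ℕ)
open import Data.Fin using (Fin)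
open import Data.Fin.Subset using (Subset; _∈_; ∣_∣)
open import Data.Vec using (Vec; lookup)
open import Data.Product using (∃; ∃-syntax; _×_; Σ-syntax)
open import Data.Nat using (_≤_)
open import Function using (_∘_)
open import Relation.Nullary using (¬_)
open import Relation.Binary.PropositionalEquality using (_≡_; _≢_)
open import Relation.Binary.Construct.Closure.Transitive using (TransClosure)

Config : ℕ → Set
Config n = Vec Bool n

AN : ℕ → Set
AN n = Config n → Config n

-- Arc (i , j) of the interaction graph G(F): f_j effectively depends on x_i.
Arc : ∀ {n} → AN n → Fin n → Fin n → Set
Arc {n} F i j =
  ∃[ x ] ∃[ x′ ] ((∀ (k : Fin n) → k ≢ i → lookup x k ≡ lookup x′ k)
                 × lookup (F x) j ≢ lookup (F x′) j)

DegreeAtMost : ∀ {n} → ℕ → AN n → Set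
DegreeAtMost {n} d F =
  ∀ (j : Fin n) (S : Subset n) → (∀ i → i ∈ S → Arc F i j) → ∣ S ∣ ≤ d

ArcWithout : ∀ {n} → AN n → Fin n → Fin n → Fin n → Set
ArcWithout F v i j = (i ≢ v) × (j ≢ v) × Arc F i j

-- A directed graph (relation) on Fin n is acyclic: no node reaches itself
-- by a nonempty path (self-loops count as cycles).
Acyclic : ∀ {n} → (Fin n → Fin n → Set) → Set
Acyclic {n} R = ∀ (i : Fin n) → ¬ TransClosure R i i

Centralized : ∀ {n} → AN n → Set
Centralized {n} F = ∃[ v ] Acyclic (ArcWithout F v)

iter : ∀ {n} → AN n → ℕ → Config n → Config n
iter F ℕ.zero x = x
iter F (ℕ.suc k) x = F (iter F k x)

CycleRepresentatives : ∀ {n} → AN n → (c : ℕ) → (Fin c → Config n) → Set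
CycleRepresentatives {n} F c rs =
  (∀ (x : Config n) → ∃[ i ] ∃[ k ] iter F k (rs i) ≡ x)
  × (∀ (i j : Fin c) (k : ℕ) → iter F k (rs i) ≡ rs j → i ≡ j)

-- F (a bijection) has exactly c limit cycles.
NumLimitCycles : ∀ {n} → AN n → ℕ → Set
NumLimitCycles {n} F c = ∃[ rs ] CycleRepresentatives F c rs

-- Composing a permutation with a transposition changes its number of cycles by exactly one,
-- so composing with an involution whose transpositions come in pairs preserves the parity of
-- the number of cycles. Let v be the centre and u a sink of G(F) - v: flipping x_u can only
-- change f_v, and by injectivity it always does. Since f_v has fewer than n inputs, it ignores
-- some x_w. Then F = S ∘ H ∘ T, where T sets x_u to f_v(x), S exchanges the coordinates u and v,
-- and H = S ∘ F ∘ T. The transpositions of T are paired by flipping x_w, and those of S by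
-- flipping a third coordinate (here n ≥ 3 is used), so F and H have cycle counts of the same
-- parity. Finally H preserves x_u and commutes with flipping x_u, and this flip maps every cycle
-- of H to a different one, so H has an even number of cycles.

module Submission where

open import Defs
open import Data.Nat using (ℕ; _≤_; _<_)
open import Data.Nat.Divisibility using (_∣_)
open import Function.Definitions using (Bijective)
open import Relation.Binary.PropositionalEquality using (_≡_)

open import Algebra.Consequences.Propositional using (selfInverse⇒bijective)
open import Data.Bool.Base using (Bool; true; false; not; _xor_)
import Data.Bool.Properties as Bool
open import Data.Bool.Properties using (xor-same; xor-comm; xor-identityʳ; not-¬; ¬-not; not-involutive)
open import Data.Empty using (⊥-elim)
open import Data.Fin as Fin using (Fin; zero; suc)
import Data.Fin.Properties as FinP
open import Data.Fin.Subset using (⊤)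
open import Data.Fin.Subset.Properties using (∣⊤∣≡n)
open import Data.List.Base as List using (List; []; _∷_; _++_)
open import Data.List.Membership.Propositional using (lose) renaming (_∈_ to _∈ₗ_)
open import Data.List.Membership.Propositional.Properties using (∈-map⁺; ∈-++⁺ˡ; ∈-++⁺ʳ)
open import Data.List.Relation.Unary.Any as Any using (Any; here; there)
open import Data.Nat.Base using (zero; suc; _+_; _*_; _∸_; z≤n; s≤s; parity)
open import Data.Nat.Divisibility using (_∣0; ∣-refl; ∣m∣n⇒∣m+n)
open import Data.Nat.Properties
  using (+-comm; +-suc; ≤-refl; _≤?_; <-cmp; <⇒≱; ≰⇒>; n<1+n; m<m+n; m<n⇒m<1+n; m≤n⇒m<n∨m≡n;
         m∸n+n≡m; suc-injective)
open import Data.Nat.Solver using (module +-*-Solver)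
open +-*-Solver using (solve; _:+_; _:*_; _:=_; con)
open import Data.Parity.Base using (Parity; 0ℙ; _⁻¹)
open import Data.Parity.Properties using (⁻¹-selfInverse; ⁻¹-involutive; suc-homo-⁻¹)
open import Data.Product as Product using (Σ; ∃; ∃-syntax; _×_; _,_; proj₁; proj₂)
open import Data.Sum as Sum using (_⊎_; inj₁; inj₂; [_,_]′)
open import Data.Vec.Base as Vec using ([]; _∷_; lookup; updateAt; _[_]≔_; tabulate)
open import Data.Vec.Properties
  using (≡-dec; tabulate∘lookup; tabulate-cong; lookup∘tabulate; lookup∘updateAt; lookup∘updateAt′; lookup∘update′;
         updateAt-updateAt; updateAt-id-local; updateAt-cong-local; updateAt-commutes)
open import Function using (_∘_; id; case_of_)
import Function.Construct.Composition as Composition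
open import Function.Definitions using (Injective; Surjective)
open import Relation.Binary.Construct.Closure.Transitive using (TransClosure; [_]; _∷_)
open import Relation.Binary.Definitions using (DecidableEquality; tri<; tri≈; tri>)
open import Relation.Binary.PropositionalEquality
  using (_≢_; refl; sym; trans; cong; cong₂; cong-app; subst; _≗_; module ≡-Reasoning)
open import Relation.Nullary using (¬_; ¬?; Dec; yes; no; _⊎-dec_; _×-dec_)
import Relation.Nullary.Decidable as Dec
open import Relation.Nullary.Decidable using (decidable-stable)
open import Relation.Unary using (Decidable)

least : ∀ {P : ℕ → Set} → Decidable P → ∀ {k} → P k →
        ∃[ r ] P r × (∀ {m} → m < r → ¬ P m)
least P? {zero} p = 0 , p , λ ()
least P? {suc k} p with P? 0
... | yes p0 = 0 , p0 , λ ()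
... | no ¬p0 with least (P? ∘ suc) p
...   | r , pr , below = suc r , pr , λ { {zero} _ → ¬p0 ; {suc m} (s≤s m<r) → below m<r }

parity≡0ℙ⇒2∣ : ∀ n → parity n ≡ 0ℙ → 2 ∣ n
parity≡0ℙ⇒2∣ zero          _  = 2 ∣0
parity≡0ℙ⇒2∣ (suc (suc n)) eq = ∣m∣n⇒∣m+n (∣-refl {2}) (parity≡0ℙ⇒2∣ n eq)

module _ {c} {ι : Fin c → Fin c} (ι-involutive : ∀ i → ι (ι i) ≡ i) (ι-fixedPointFree : ∀ i → ι i ≢ i) where
  open import Data.Fin.Subset using (Subset; inside; outside; _∈_; _-_; ∣_∣)
  open import Data.Fin.Subset.Properties
    using (p─⊥≡p; p─q⊆p; x∈p∧x≢y⇒x∈p-y; nonempty?; Empty-unique; ∣⊥∣≡0; ∈⊤)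
  open import Data.Vec.Base using (_∷_; here; there)

  ∣p∣≡1+∣p-x∣ : ∀ {n} {p : Subset n} {x} → x ∈ p → ∣ p ∣ ≡ suc ∣ p - x ∣
  ∣p∣≡1+∣p-x∣ {p = inside  ∷ p} here        = cong (suc ∘ ∣_∣) (sym (p─⊥≡p p))
  ∣p∣≡1+∣p-x∣ {p = inside  ∷ p} (there x∈p) = cong suc (∣p∣≡1+∣p-x∣ x∈p)
  ∣p∣≡1+∣p-x∣ {p = outside ∷ p} (there x∈p) = ∣p∣≡1+∣p-x∣ x∈p

  x∉p-x : ∀ {n} (p : Subset n) x → ¬ x ∈ p - x
  x∉p-x (s ∷ p) zero    ()
  x∉p-x (s ∷ p) (suc x) (there x∈p-x) = x∉p-x p x x∈p-x

  Closed : ∀ (p : Subset c) → Set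
  Closed p = ∀ {i} → i ∈ p → ι i ∈ p

  Closed-removePair : ∀ {p x} → Closed p → x ∈ p → ∃[ q ] Closed q × ∣ p ∣ ≡ suc (suc ∣ q ∣)
  Closed-removePair {p} {x} closed x∈p =
    p - x - ι x , closed′ , trans (∣p∣≡1+∣p-x∣ x∈p) (cong suc (∣p∣≡1+∣p-x∣ ιx∈p-x))
    where
    ιx∈p-x : ι x ∈ p - x
    ιx∈p-x = x∈p∧x≢y⇒x∈p-y (closed x∈p) (ι-fixedPointFree x)
    closed′ : Closed (p - x - ι x)
    closed′ {i} i∈q = x∈p∧x≢y⇒x∈p-y (x∈p∧x≢y⇒x∈p-y (closed i∈p) ιi≢x) ιi≢ιx
      where
      i∈p-x = p─q⊆p _ _ i∈q
      i∈p = p─q⊆p _ _ i∈p-x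
      ιi≢x : ι i ≢ x
      ιi≢x ιi≡x = x∉p-x (p - x) (ι x) (subst (λ j → j ∈ p - x - ι x)
                    (trans (sym (ι-involutive i)) (cong ι ιi≡x)) i∈q)
      ιi≢ιx : ι i ≢ ι x
      ιi≢ιx ιi≡ιx = x∉p-x p x (subst (_∈ p - x)
                      (trans (sym (ι-involutive i)) (trans (cong ι ιi≡ιx) (ι-involutive x))) i∈p-x)

  Closed-even : ∀ k {p} → ∣ p ∣ ≡ k → Closed p → parity k ≡ 0ℙ
  Closed-even zero _ _ = refl
  Closed-even (suc k) {p} ∣p∣≡1+k closed with nonempty? p
  ... | no empty = case trans (sym ∣p∣≡1+k) (trans (cong ∣_∣ (Empty-unique empty)) (∣⊥∣≡0 c)) of λ ()
  ... | yes (x , x∈p) with Closed-removePair closed x∈p | k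
  ...   | q , closed′ , ∣p∣≡2+∣q∣ | zero = case trans (sym ∣p∣≡1+k) ∣p∣≡2+∣q∣ of λ ()
  ...   | q , closed′ , ∣p∣≡2+∣q∣ | suc k′ =
    Closed-even k′ (suc-injective (suc-injective (trans (sym ∣p∣≡2+∣q∣) ∣p∣≡1+k))) closed′

  involution-fixedPointFree⇒even : parity c ≡ 0ℙ
  involution-fixedPointFree⇒even = Closed-even c (∣⊤∣≡n c) (λ _ → ∈⊤)

module Orbits {X : Set} where
  open import Function.Endo.Propositional X public using (_^_)
  open import Function.Endo.Propositional X using (^-homo)

  ^-+ : ∀ f m n x → (f ^ (m + n)) x ≡ (f ^ m) ((f ^ n) x)
  ^-+ f m n x = cong-app (^-homo f m n) x

  ^-comm : ∀ f m n x → (f ^ m) ((f ^ n) x) ≡ (f ^ n) ((f ^ m) x)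
  ^-comm f m n x = begin
    (f ^ m) ((f ^ n) x)  ≡⟨ ^-+ f m n x ⟨
    (f ^ (m + n)) x      ≡⟨ cong (λ k → (f ^ k) x) (+-comm m n) ⟩
    (f ^ (n + m)) x      ≡⟨ ^-+ f n m x ⟩
    (f ^ n) ((f ^ m) x)  ∎
    where open ≡-Reasoning

  ^-cong : ∀ {f g} → f ≗ g → ∀ k → (f ^ k) ≗ (g ^ k)
  ^-cong f≗g zero x = refl
  ^-cong {f} {g} f≗g (suc k) x = trans (cong f (^-cong f≗g k x)) (f≗g _)

  ^-injective : ∀ {f} → Injective _≡_ _≡_ f → ∀ k → Injective _≡_ _≡_ (f ^ k)
  ^-injective inj zero eq = eq
  ^-injective inj (suc k) eq = ^-injective inj k (inj eq)

  Reach : (X → X) → X → X → Set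
  Reach f x y = ∃[ k ] (f ^ k) x ≡ y

  Periodic : (X → X) → X → Set
  Periodic f x = ∃[ p ] (f ^ suc p) x ≡ x

  Reach-trans : ∀ {f x y z} → Reach f x y → Reach f y z → Reach f x z
  Reach-trans {f} {x} (k , fᵏx≡y) (m , fᵐy≡z) =
    m + k , trans (^-+ f m k x) (trans (cong (f ^ m) fᵏx≡y) fᵐy≡z)

  Periodic-multiple : ∀ {f x p} → (f ^ suc p) x ≡ x → ∀ q → (f ^ (q * suc p)) x ≡ x
  Periodic-multiple fᵖx≡x zero = refl
  Periodic-multiple {f} {x} {p} fᵖx≡x (suc q) =
    trans (^-+ f (suc p) (q * suc p) x)
          (trans (cong (f ^ suc p) (Periodic-multiple fᵖx≡x q)) fᵖx≡x)

  Periodic⇒Reach-sym : ∀ {f x y} → Periodic f x → Reach f x y → Reach f y x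
  Periodic⇒Reach-sym {f} {x} {y} (p , fᵖx≡x) (k , fᵏx≡y) = p * k , (begin
    (f ^ (p * k)) y              ≡⟨ cong (f ^ (p * k)) fᵏx≡y ⟨
    (f ^ (p * k)) ((f ^ k) x)    ≡⟨ ^-+ f (p * k) k x ⟨
    (f ^ (p * k + k)) x          ≡⟨ cong (λ m → (f ^ m) x) p*k+k≡k*[1+p] ⟩
    (f ^ (k * suc p)) x          ≡⟨ Periodic-multiple fᵖx≡x k ⟩
    x                            ∎)
    where
    open ≡-Reasoning
    p*k+k≡k*[1+p] : p * k + k ≡ k * suc p
    p*k+k≡k*[1+p] = solve 2 (λ p k → p :* k :+ k := k :* (con 1 :+ p)) refl p k

  Reach-Periodic : ∀ {f x y} → Injective _≡_ _≡_ f → Reach f x y → Periodic f y → Periodic f x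
  Reach-Periodic {f} {x} inj (k , fᵏx≡y) (p , fᵖy≡y) = p , ^-injective inj k (begin
    (f ^ k) ((f ^ suc p) x)      ≡⟨ ^-comm f k (suc p) x ⟩
    (f ^ suc p) ((f ^ k) x)      ≡⟨ cong (f ^ suc p) fᵏx≡y ⟩
    (f ^ suc p) _                ≡⟨ fᵖy≡y ⟩
    _                            ≡⟨ fᵏx≡y ⟨
    (f ^ k) x                    ∎)
    where open ≡-Reasoning

  Reach⇒Reach-sym : ∀ {f x y} → Injective _≡_ _≡_ f → Periodic f y → Reach f x y → Reach f y x
  Reach⇒Reach-sym inj y-per x↝y = Periodic⇒Reach-sym (Reach-Periodic inj x↝y y-per) x↝y

  step⇒Periodic : ∀ {f x z} → f x ≡ z → Reach f z x → Periodic f x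
  step⇒Periodic {f} {x} fx≡z (k , fᵏz≡x) =
    k , trans (sym (^-comm f k 1 x)) (trans (cong (f ^ k) fx≡z) fᵏz≡x)

  first-return-bound : ∀ {f x y p r} → (f ^ suc p) x ≡ x → (f ^ r) x ≡ y →
                       (∀ {m} → m < r → (f ^ m) x ≢ y) → r ≤ p
  first-return-bound {f} {x} {y} {p} {r} fᵖx≡x fʳx≡y earlier with r ≤? p
  ... | yes r≤p = r≤p
  ... | no r≰p = ⊥-elim (earlier d<r (begin
      (f ^ d) x                  ≡⟨ cong (f ^ d) fᵖx≡x ⟨
      (f ^ d) ((f ^ suc p) x)    ≡⟨ ^-+ f d (suc p) x ⟨
      (f ^ (d + suc p)) x        ≡⟨ cong (λ k → (f ^ k) x) d+p≡r ⟩
      (f ^ r) x                  ≡⟨ fʳx≡y ⟩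
      y                          ∎))
    where
    open ≡-Reasoning
    d = r ∸ suc p
    d+p≡r : d + suc p ≡ r
    d+p≡r = m∸n+n≡m (≰⇒> r≰p)
    d<r : d < r
    d<r = subst (d <_) d+p≡r (m<m+n d (s≤s z≤n))

  Reach-≗ : ∀ {f g x y} → f ≗ g → Reach f x y → Reach g x y
  Reach-≗ {x = x} f≗g (k , fᵏx≡y) = k , trans (sym (^-cong f≗g k x)) fᵏx≡y

  record CycleSystem (f : X → X) (c : ℕ) : Set where
    field
      rep          : Fin c → X
      rep-covers   : ∀ x → ∃[ i ] Reach f (rep i) x
      rep-distinct : ∀ {i j} → Reach f (rep i) (rep j) → i ≡ j

  CycleParity : (X → X) → Parity → Set
  CycleParity f p = ∃[ c ] CycleSystem f c × parity c ≡ p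

  CycleSystem-≗ : ∀ {f g c} → f ≗ g → CycleSystem f c → CycleSystem g c
  CycleSystem-≗ f≗g S = record
    { rep          = rep
    ; rep-covers   = λ x → let i , r = rep-covers x in i , Reach-≗ f≗g r
    ; rep-distinct = λ r → rep-distinct (Reach-≗ (sym ∘ f≗g) r)
    }
    where open CycleSystem S

  CycleParity-≗ : ∀ {f g p} → f ≗ g → CycleParity f p → CycleParity g p
  CycleParity-≗ f≗g (c , S , eq) = c , CycleSystem-≗ f≗g S , eq

  ^-conjugate : ∀ (A B : X → X) k x → ((B ∘ A) ^ k) (B x) ≡ B (((A ∘ B) ^ k) x)
  ^-conjugate A B zero x = refl
  ^-conjugate A B (suc k) x = cong (B ∘ A) (^-conjugate A B k x)

  CycleSystem-rotate : ∀ {A B c} → Bijective _≡_ _≡_ B →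
                       CycleSystem (A ∘ B) c → CycleSystem (B ∘ A) c
  CycleSystem-rotate {A} {B} (B-inj , B-surj) S = record
    { rep          = B ∘ rep
    ; rep-covers   = covers
    ; rep-distinct = λ (k , eq) →
        rep-distinct (k , B-inj (trans (sym (^-conjugate A B k _)) eq))
    }
    where
    open CycleSystem S
    covers : ∀ y → ∃[ i ] Reach (B ∘ A) (B (rep i)) y
    covers y with B-surj y
    ... | x , Bx≡y with rep-covers x
    ...   | i , k , eq = i , k , trans (^-conjugate A B k (rep i)) (trans (cong B eq) (Bx≡y refl))

  CycleParity-rotate : ∀ {A B p} → Bijective _≡_ _≡_ B →
                       CycleParity (A ∘ B) p → CycleParity (B ∘ A) p
  CycleParity-rotate B-bij (c , S , eq) = c , CycleSystem-rotate B-bij S , eq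

  module CycleIndex {f : X → X} (f-surj : Surjective _≡_ _≡_ f) {c} (S : CycleSystem f c) where
    open CycleSystem S public

    cycleOf : X → Fin c
    cycleOf x = proj₁ (rep-covers x)

    Reach-rep-cycleOf : ∀ x → Reach f (rep (cycleOf x)) x
    Reach-rep-cycleOf x = proj₂ (rep-covers x)

    rep-periodic : ∀ i → Periodic f (rep i)
    rep-periodic i with f-surj (rep i)
    ... | x , fx≡rep with rep-covers x
    ...   | j , k , fᵏrep≡x with refl ← rep-distinct (suc k , trans (cong f fᵏrep≡x) (fx≡rep refl)) =
      k , trans (cong f fᵏrep≡x) (fx≡rep refl)

    cycleOf-rep : ∀ i → cycleOf (rep i) ≡ i
    cycleOf-rep i = rep-distinct (Reach-rep-cycleOf (rep i))

    Reach⇒cycleOf≡ : ∀ {x y} → Reach f x y → cycleOf x ≡ cycleOf y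
    Reach⇒cycleOf≡ {x} {y} x↝y = rep-distinct
      (Reach-trans (Reach-trans (Reach-rep-cycleOf x) x↝y)
                   (Periodic⇒Reach-sym (rep-periodic (cycleOf y)) (Reach-rep-cycleOf y)))

    cycleOf≡⇒Reach : ∀ {x y} → cycleOf x ≡ cycleOf y → Reach f x y
    cycleOf≡⇒Reach {x} {y} eq =
      Reach-trans (Periodic⇒Reach-sym (rep-periodic (cycleOf x)) (Reach-rep-cycleOf x))
                  (subst (λ i → Reach f (rep i) y) (sym eq) (Reach-rep-cycleOf y))

    cycleOf-^ : ∀ k x → cycleOf ((f ^ k) x) ≡ cycleOf x
    cycleOf-^ k x = sym (Reach⇒cycleOf≡ (k , refl))

    cycleOf-f : ∀ x → cycleOf (f x) ≡ cycleOf x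
    cycleOf-f = cycleOf-^ 1

  -- σ pairs up the cycles of f, and never maps a cycle to itself because it switches the side.
  CycleSystem-even : ∀ {f σ c} → Surjective _≡_ _≡_ f →
    (∀ x → σ (σ x) ≡ x) → (∀ x → f (σ x) ≡ σ (f x)) →
    (side : X → Bool) → (∀ x → side (f x) ≡ side x) → (∀ x → side (σ x) ≡ not (side x)) →
    CycleSystem f c → parity c ≡ 0ℙ
  CycleSystem-even {f} {σ} {c} f-surj σ-involutive fσ≡σf side side-f side-σ S =
    involution-fixedPointFree⇒even ι-involutive ι-fixedPointFree
    where
    open CycleIndex f-surj S

    σ-Reach : ∀ {x y} → Reach f x y → Reach f (σ x) (σ y)
    σ-Reach {x} (k , fᵏx≡y) = k , trans (sym (σ-^ k)) (cong σ fᵏx≡y)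
      where
      σ-^ : ∀ k → σ ((f ^ k) x) ≡ (f ^ k) (σ x)
      σ-^ zero    = refl
      σ-^ (suc k) = trans (sym (fσ≡σf _)) (cong f (σ-^ k))

    side-Reach : ∀ {x y} → Reach f x y → side y ≡ side x
    side-Reach {x} (k , refl) = side-^ k
      where
      side-^ : ∀ k → side ((f ^ k) x) ≡ side x
      side-^ zero    = refl
      side-^ (suc k) = trans (side-f _) (side-^ k)

    ι : Fin c → Fin c
    ι i = cycleOf (σ (rep i))

    ι-involutive : ∀ i → ι (ι i) ≡ i
    ι-involutive i = trans (Reach⇒cycleOf≡ (subst (Reach f _) (σ-involutive (rep i))
                                             (σ-Reach (Reach-rep-cycleOf (σ (rep i))))))
                           (cycleOf-rep i)

    ι-fixedPointFree : ∀ i → ι i ≢ i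
    ι-fixedPointFree i ιi≡i = not-¬ refl (trans (sym (side-Reach rep↝σrep)) (side-σ (rep i)))
      where
      rep↝σrep : Reach f (rep i) (σ (rep i))
      rep↝σrep = cycleOf≡⇒Reach (trans (cycleOf-rep i) (sym ιi≡i))

  CycleSystem-fromClasses : ∀ {g c} (Class : Fin c → X → Set) (rep : Fin c → X) →
    (∀ {i x} → Class i x → Class i (g x)) →
    (∀ {i j x} → Class i x → Class j x → i ≡ j) →
    (∀ i → Class i (rep i)) →
    (∀ y → ∃[ i ] Reach g (rep i) y) →
    CycleSystem g c
  CycleSystem-fromClasses {g} Class rep Class-g Class-unique Class-rep covers = record
    { rep          = rep
    ; rep-covers   = covers
    ; rep-distinct = λ {i} (k , gᵏrepᵢ≡repⱼ) →
        Class-unique (subst (Class i) gᵏrepᵢ≡repⱼ (Class-^ k (Class-rep i))) (Class-rep _)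
    }
    where
    Class-^ : ∀ {i x} k → Class i x → Class i ((g ^ k) x)
    Class-^ zero    cl = cl
    Class-^ (suc k) cl = Class-g (Class-^ k cl)

  ∘-bijective : ∀ {f g : X → X} → Bijective _≡_ _≡_ f → Bijective _≡_ _≡_ g → Bijective _≡_ _≡_ (f ∘ g)
  ∘-bijective {f} {g} f-bij g-bij = Composition.bijective _≡_ _≡_ _≡_ {f = g} {g = f} g-bij f-bij

  involution⇒bijective : ∀ {f : X → X} → (∀ x → f (f x) ≡ x) → Bijective _≡_ _≡_ f
  involution⇒bijective invol = selfInverse⇒bijective λ { refl → invol _ }

module Transpositions {X : Set} (_≟_ : DecidableEquality X) where
  open Orbits {X}

  transpose : X → X → X → X
  transpose a b x with x ≟ a
  ... | yes _ = b
  ... | no _ with x ≟ b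
  ...   | yes _ = a
  ...   | no _ = x

  transpose-a : ∀ a b → transpose a b a ≡ b
  transpose-a a b with a ≟ a
  ... | yes _ = refl
  ... | no a≢a = ⊥-elim (a≢a refl)

  transpose-b : ∀ a b → transpose a b b ≡ a
  transpose-b a b with b ≟ a
  ... | yes b≡a = b≡a
  ... | no _ with b ≟ b
  ...   | yes _ = refl
  ...   | no b≢b = ⊥-elim (b≢b refl)

  transpose-other : ∀ {a b x} → x ≢ a → x ≢ b → transpose a b x ≡ x
  transpose-other {a} {b} {x} x≢a x≢b with x ≟ a
  ... | yes x≡a = ⊥-elim (x≢a x≡a)
  ... | no _ with x ≟ b
  ...   | yes x≡b = ⊥-elim (x≢b x≡b)
  ...   | no _ = refl

  transpose-involutive : ∀ a b x → transpose a b (transpose a b x) ≡ x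
  transpose-involutive a b x = by-cases (x ≟ a) (x ≟ b)
    where
    by-cases : Dec (x ≡ a) → Dec (x ≡ b) → transpose a b (transpose a b x) ≡ x
    by-cases (yes refl) _        = trans (cong (transpose a b) (transpose-a a b)) (transpose-b a b)
    by-cases (no _)     (yes refl) = trans (cong (transpose a b) (transpose-b a b)) (transpose-a a b)
    by-cases (no x≢a)   (no x≢b)   =
      trans (cong (transpose a b) (transpose-other x≢a x≢b)) (transpose-other x≢a x≢b)

  transpose-invariant : ∀ {Y : Set} (φ : X → Y) {a b} → φ a ≡ φ b → ∀ x → φ (transpose a b x) ≡ φ x
  transpose-invariant φ {a} {b} φa≡φb x = by-cases (x ≟ a) (x ≟ b)
    where
    by-cases : Dec (x ≡ a) → Dec (x ≡ b) → φ (transpose a b x) ≡ φ x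
    by-cases (yes refl) _        = trans (cong φ (transpose-a a b)) (sym φa≡φb)
    by-cases (no _)     (yes refl) = trans (cong φ (transpose-b a b)) φa≡φb
    by-cases (no x≢a)   (no x≢b)   = cong φ (transpose-other x≢a x≢b)

  module Transposed {f : X → X} (f-bij : Bijective _≡_ _≡_ f) {c} (S : CycleSystem f c)
                       {a b : X} (a≢b : a ≢ b) where
    open CycleIndex (proj₂ f-bij) S public

    g : X → X
    g = f ∘ transpose a b

    g-injective : Injective _≡_ _≡_ g
    g-injective = proj₁ (∘-bijective f-bij (involution⇒bijective (transpose-involutive a b)))

    g-a : g a ≡ f b
    g-a = cong f (transpose-a a b)

    g-b : g b ≡ f a
    g-b = cong f (transpose-b a b)

    Marked : X → Set
    Marked x = x ≡ a ⊎ x ≡ b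

    marked? : Decidable Marked
    marked? x = (x ≟ a) ⊎-dec (x ≟ b)

    g-unmarked : ∀ {x} → ¬ Marked x → g x ≡ f x
    g-unmarked ¬marked = cong f (transpose-other (¬marked ∘ inj₁) (¬marked ∘ inj₂))

    ^-agree : ∀ {x} k → (∀ {m} → m < k → ¬ Marked ((f ^ m) x)) → (g ^ k) x ≡ (f ^ k) x
    ^-agree zero    _        = refl
    ^-agree (suc k) unmarked =
      trans (cong g (^-agree k (unmarked ∘ m<n⇒m<1+n))) (g-unmarked (unmarked ≤-refl))

    record HitsFirst (x h : X) : Set where
      constructor hitsFirst
      field
        steps  : ℕ
        hits   : (f ^ steps) x ≡ h
        marked : Marked h
        avoids : ∀ {m} → m < steps → ¬ Marked ((f ^ m) x)

    HitsFirst-refl : ∀ {x} → Marked x → HitsFirst x x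
    HitsFirst-refl m = hitsFirst 0 refl m λ ()

    HitsFirst⇒Reach-g : ∀ {x h} → HitsFirst x h → Reach g x h
    HitsFirst⇒Reach-g (hitsFirst k hits _ avoids) = k , trans (^-agree k avoids) hits

    HitsFirst-unique : ∀ {x h h′} → HitsFirst x h → HitsFirst x h′ → h ≡ h′
    HitsFirst-unique (hitsFirst k hits m avoids) (hitsFirst k′ hits′ m′ avoids′) with <-cmp k k′
    ... | tri< k<k′ _ _ = ⊥-elim (avoids′ k<k′ (subst Marked (sym hits) m))
    ... | tri≈ _ refl _ = trans (sym hits) hits′
    ... | tri> _ _ k′<k = ⊥-elim (avoids k′<k (subst Marked (sym hits′) m′))

    HitsFirst-self : ∀ {x h} → Marked x → HitsFirst x h → h ≡ x
    HitsFirst-self m H = HitsFirst-unique H (HitsFirst-refl m)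

    HitsFirst-f : ∀ {x h} → ¬ Marked x → HitsFirst x h → HitsFirst (f x) h
    HitsFirst-f ¬m (hitsFirst zero refl m _) = ⊥-elim (¬m m)
    HitsFirst-f {x} ¬m (hitsFirst (suc k) hits m avoids) =
      hitsFirst k (trans (^-comm f k 1 x) hits) m
        λ {m} m<k → avoids (s≤s m<k) ∘ subst Marked (^-comm f m 1 x)

    HitsFirst-cycleOf : ∀ {x h} → HitsFirst x h → cycleOf h ≡ cycleOf x
    HitsFirst-cycleOf {x} (hitsFirst k hits _ _) = trans (cong cycleOf (sym hits)) (cycleOf-^ k x)

    HitsFirst-exists : ∀ {x} → cycleOf x ≡ cycleOf a ⊎ cycleOf x ≡ cycleOf b → ∃ (HitsFirst x)
    HitsFirst-exists {x} same-cycle =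
      let k , marked = marked-reachable same-cycle
          r , markedʳ , earlier = least (λ m → marked? ((f ^ m) x)) {k} marked
      in (f ^ r) x , hitsFirst r refl markedʳ earlier
      where
      marked-reachable : cycleOf x ≡ cycleOf a ⊎ cycleOf x ≡ cycleOf b → ∃[ k ] Marked ((f ^ k) x)
      marked-reachable (inj₁ eq) = Product.map₂ inj₁ (cycleOf≡⇒Reach eq)
      marked-reachable (inj₂ eq) = Product.map₂ inj₂ (cycleOf≡⇒Reach eq)

    HitsFirst-a : ∀ {x h} → HitsFirst x h → h ≢ b → HitsFirst x a
    HitsFirst-a {x} H h≢b = [ (λ h≡a → subst (HitsFirst x) h≡a H) , ⊥-elim ∘ h≢b ]′ (HitsFirst.marked H)

    HitsFirst-b : ∀ {x h} → HitsFirst x h → h ≢ a → HitsFirst x b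
    HitsFirst-b {x} H h≢a = [ ⊥-elim ∘ h≢a , (λ h≡b → subst (HitsFirst x) h≡b H) ]′ (HitsFirst.marked H)

    Reach-g-marked : ∀ {y} → cycleOf y ≡ cycleOf a ⊎ cycleOf y ≡ cycleOf b → Reach g y a ⊎ Reach g y b
    Reach-g-marked {y} same-cycle =
      let _ , H = HitsFirst-exists same-cycle
          y↝h = HitsFirst⇒Reach-g H
      in Sum.map (λ h≡a → subst (Reach g y) h≡a y↝h) (λ h≡b → subst (Reach g y) h≡b y↝h) (HitsFirst.marked H)

    -- Before the orbit of s comes back to s, it passes through every other point of its cycle.
    HitsFirst-next : ∀ {s t h} → Marked t → s ≢ t → cycleOf s ≡ cycleOf t →
                     HitsFirst (f s) h → h ≢ s
    HitsFirst-next {s} {t} mt s≢t same (hitsFirst r hits _ avoids) refl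
      with cycleOf≡⇒Reach {f s} {t} (trans (cycleOf-f s) same)
    ... | k , fᵏfs≡t with least (λ n → (f ^ n) (f s) ≟ t) {k} fᵏfs≡t
    ...   | k′ , fᵏ′fs≡t , earlier
      with m≤n⇒m<n∨m≡n (first-return-bound (cong f hits) fᵏ′fs≡t earlier)
    ...     | inj₁ k′<r = avoids k′<r (subst Marked (sym fᵏ′fs≡t) mt)
    ...     | inj₂ refl = s≢t (trans (sym hits) fᵏ′fs≡t)

    Reach-g-untouched : ∀ {y} → cycleOf y ≢ cycleOf a → cycleOf y ≢ cycleOf b →
                        Reach g (rep (cycleOf y)) y
    Reach-g-untouched {y} ≢a ≢b with Reach-rep-cycleOf y
    ... | k , fᵏrep≡y = k , trans (^-agree k (λ {m} _ → unmarked m)) fᵏrep≡y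
      where
      unmarked : ∀ m → ¬ Marked ((f ^ m) (rep (cycleOf y)))
      unmarked m (inj₁ eq) = ≢a (trans (sym (trans (cycleOf-^ m _) (cycleOf-rep _))) (cong cycleOf eq))
      unmarked m (inj₂ eq) = ≢b (trans (sym (trans (cycleOf-^ m _) (cycleOf-rep _))) (cong cycleOf eq))

    module Split (same : cycleOf a ≡ cycleOf b) where
      f-b-hits-a : HitsFirst (f b) a
      f-b-hits-a = let _ , H = HitsFirst-exists (inj₂ (cycleOf-f b)) in
        HitsFirst-a H (HitsFirst-next (inj₁ refl) (a≢b ∘ sym) (sym same) H)

      f-a-hits-b : HitsFirst (f a) b
      f-a-hits-b = let _ , H = HitsFirst-exists (inj₁ (cycleOf-f a)) in
        HitsFirst-b H (HitsFirst-next (inj₂ refl) a≢b same H)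

      HitsFirst-g : ∀ {x h} → HitsFirst x h → HitsFirst (g x) h
      HitsFirst-g {x} {h} H = by-cases (x ≟ a) (x ≟ b)
        where
        by-cases : Dec (x ≡ a) → Dec (x ≡ b) → HitsFirst (g x) h
        by-cases (yes refl) _ rewrite HitsFirst-self (inj₁ refl) H | g-a = f-b-hits-a
        by-cases (no _) (yes refl) rewrite HitsFirst-self (inj₂ refl) H | g-b = f-a-hits-b
        by-cases (no x≢a) (no x≢b) rewrite g-unmarked [ x≢a , x≢b ]′ = HitsFirst-f [ x≢a , x≢b ]′ H

      cycleOf-g : ∀ x → cycleOf (g x) ≡ cycleOf x
      cycleOf-g x = trans (cycleOf-f _) (transpose-invariant cycleOf same x)

      HitsFirst⇒cycleOf≢ : ∀ {x h j} → HitsFirst x h → j ≢ cycleOf a → cycleOf x ≢ j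
      HitsFirst⇒cycleOf≢ H j≢a x-in-j = j≢a (trans (sym x-in-j) (trans (sym (HitsFirst-cycleOf H))
        ([ cong cycleOf , (λ h≡b → trans (cong cycleOf h≡b) (sym same)) ]′ (HitsFirst.marked H))))

      -- Cycle 0 and cycle (1 + cycleOf a) are the two halves into which the cycle of a and b splits.
      Class : Fin (suc c) → X → Set
      Class zero    x = HitsFirst x a
      Class (suc j) x = (j ≡ cycleOf a × HitsFirst x b) ⊎ (j ≢ cycleOf a × cycleOf x ≡ j)

      Class-g : ∀ {i x} → Class i x → Class i (g x)
      Class-g {zero}  H                 = HitsFirst-g H
      Class-g {suc j} (inj₁ (eq , H))   = inj₁ (eq , HitsFirst-g H)
      Class-g {suc j} (inj₂ (ne , eq))  = inj₂ (ne , trans (cycleOf-g _) eq)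

      Class-unique : ∀ {i j x} → Class i x → Class j x → i ≡ j
      Class-unique {zero}  {zero}  _ _ = refl
      Class-unique {zero}  {suc j} H (inj₁ (_ , H′)) = ⊥-elim (a≢b (HitsFirst-unique H H′))
      Class-unique {zero}  {suc j} H (inj₂ (ne , eq)) = ⊥-elim (HitsFirst⇒cycleOf≢ H ne eq)
      Class-unique {suc i} {zero}  (inj₁ (_ , H′)) H = ⊥-elim (a≢b (HitsFirst-unique H H′))
      Class-unique {suc i} {zero}  (inj₂ (ne , eq)) H = ⊥-elim (HitsFirst⇒cycleOf≢ H ne eq)
      Class-unique {suc i} {suc j} (inj₁ (eq , _)) (inj₁ (eq′ , _)) = cong suc (trans eq (sym eq′))
      Class-unique {suc i} {suc j} (inj₁ (_ , H)) (inj₂ (ne , eq)) = ⊥-elim (HitsFirst⇒cycleOf≢ H ne eq)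
      Class-unique {suc i} {suc j} (inj₂ (ne , eq)) (inj₁ (_ , H)) = ⊥-elim (HitsFirst⇒cycleOf≢ H ne eq)
      Class-unique {suc i} {suc j} (inj₂ (_ , eq)) (inj₂ (_ , eq′)) = cong suc (trans (sym eq) eq′)

      rep′ : Fin (suc c) → X
      rep′ zero = a
      rep′ (suc j) with j Fin.≟ cycleOf a
      ... | yes _ = b
      ... | no _  = rep j

      Class-rep′ : ∀ i → Class i (rep′ i)
      Class-rep′ zero = HitsFirst-refl (inj₁ refl)
      Class-rep′ (suc j) with j Fin.≟ cycleOf a
      ... | yes eq = inj₁ (eq , HitsFirst-refl (inj₂ refl))
      ... | no ne  = inj₂ (ne , cycleOf-rep j)

      rep′-b : rep′ (suc (cycleOf a)) ≡ b
      rep′-b with cycleOf a Fin.≟ cycleOf a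
      ... | yes _ = refl
      ... | no ne = ⊥-elim (ne refl)

      rep′-other : ∀ {j} → j ≢ cycleOf a → rep′ (suc j) ≡ rep j
      rep′-other {j} ne with j Fin.≟ cycleOf a
      ... | yes eq = ⊥-elim (ne eq)
      ... | no _   = refl

      periodic-a : Periodic g a
      periodic-a = step⇒Periodic g-a (HitsFirst⇒Reach-g f-b-hits-a)

      periodic-b : Periodic g b
      periodic-b = step⇒Periodic g-b (HitsFirst⇒Reach-g f-a-hits-b)

      covers : ∀ y → ∃[ i ] Reach g (rep′ i) y
      covers y with cycleOf y Fin.≟ cycleOf a
      ... | no ne = suc (cycleOf y) , subst (λ r → Reach g r y) (sym (rep′-other ne))
                      (Reach-g-untouched ne (ne ∘ (λ eq → trans eq (sym same))))
      ... | yes eq = [ (λ y↝a → zero , Reach⇒Reach-sym g-injective periodic-a y↝a)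
                     , (λ y↝b → suc (cycleOf a) , subst (λ r → Reach g r y) (sym rep′-b)
                                   (Reach⇒Reach-sym g-injective periodic-b y↝b))
                     ]′ (Reach-g-marked (inj₁ eq))

      split : CycleSystem g (suc c)
      split = CycleSystem-fromClasses Class rep′ Class-g Class-unique Class-rep′ covers

  module Merge {f : X → X} (f-bij : Bijective _≡_ _≡_ f) {c} (S : CycleSystem f (suc c))
               {a b : X} (a≢b : a ≢ b) where
    open Transposed f-bij S a≢b

    module _ (diff : cycleOf a ≢ cycleOf b) where
      merged : Fin (suc c) → Fin (suc c)
      merged i with i Fin.≟ cycleOf b
      ... | yes _ = cycleOf a
      ... | no _  = i

      merged-b : merged (cycleOf b) ≡ cycleOf a
      merged-b with cycleOf b Fin.≟ cycleOf b
      ... | yes _ = refl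
      ... | no ne = ⊥-elim (ne refl)

      merged-other : ∀ {i} → i ≢ cycleOf b → merged i ≡ i
      merged-other {i} ne with i Fin.≟ cycleOf b
      ... | yes eq = ⊥-elim (ne eq)
      ... | no _   = refl

      merged≢b : ∀ i → merged i ≢ cycleOf b
      merged≢b i with i Fin.≟ cycleOf b
      ... | yes _ = diff
      ... | no ne = ne

      mergedCycleOf : X → Fin (suc c)
      mergedCycleOf = merged ∘ cycleOf

      mergedCycleOf-a≡b : mergedCycleOf a ≡ mergedCycleOf b
      mergedCycleOf-a≡b = trans (merged-other diff) (sym merged-b)

      mergedCycleOf-g : ∀ x → mergedCycleOf (g x) ≡ mergedCycleOf x
      mergedCycleOf-g x =
        trans (cong merged (cycleOf-f _)) (transpose-invariant mergedCycleOf mergedCycleOf-a≡b x)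

      Class : Fin c → X → Set
      Class i x = mergedCycleOf x ≡ Fin.punchIn (cycleOf b) i

      rep′ : Fin c → X
      rep′ i with Fin.punchIn (cycleOf b) i Fin.≟ cycleOf a
      ... | yes _ = a
      ... | no _  = rep (Fin.punchIn (cycleOf b) i)

      Class-rep′ : ∀ i → Class i (rep′ i)
      Class-rep′ i with Fin.punchIn (cycleOf b) i Fin.≟ cycleOf a
      ... | yes eq = trans (merged-other diff) (sym eq)
      ... | no _   = trans (cong merged (cycleOf-rep _))
                           (merged-other (FinP.punchInᵢ≢i (cycleOf b) i))

      rep′-a : ∀ {i} → Fin.punchIn (cycleOf b) i ≡ cycleOf a → rep′ i ≡ a
      rep′-a {i} eq with Fin.punchIn (cycleOf b) i Fin.≟ cycleOf a
      ... | yes _ = refl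
      ... | no ne = ⊥-elim (ne eq)

      rep′-other : ∀ {i} → Fin.punchIn (cycleOf b) i ≢ cycleOf a → rep′ i ≡ rep (Fin.punchIn (cycleOf b) i)
      rep′-other {i} ne with Fin.punchIn (cycleOf b) i Fin.≟ cycleOf a
      ... | yes eq = ⊥-elim (ne eq)
      ... | no _   = refl

      f-b-hits-b : HitsFirst (f b) b
      f-b-hits-b = let _ , H = HitsFirst-exists (inj₂ (cycleOf-f b)) in
        HitsFirst-b H λ h≡a →
          diff (trans (cong cycleOf (sym h≡a)) (trans (HitsFirst-cycleOf H) (cycleOf-f b)))

      f-a-hits-a : HitsFirst (f a) a
      f-a-hits-a = let _ , H = HitsFirst-exists (inj₁ (cycleOf-f a)) in
        HitsFirst-a H λ h≡b →
          diff (sym (trans (cong cycleOf (sym h≡b)) (trans (HitsFirst-cycleOf H) (cycleOf-f a))))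

      b↝a : Reach g b a
      b↝a = Reach-trans (1 , g-b) (HitsFirst⇒Reach-g f-a-hits-a)

      periodic-a : Periodic g a
      periodic-a = step⇒Periodic g-a (Reach-trans (HitsFirst⇒Reach-g f-b-hits-b) b↝a)

      Reach-g-a : ∀ {y} → cycleOf y ≡ cycleOf a ⊎ cycleOf y ≡ cycleOf b → Reach g a y
      Reach-g-a same-cycle = Reach⇒Reach-sym g-injective periodic-a
        ([ id , (λ y↝b → Reach-trans y↝b b↝a) ]′ (Reach-g-marked same-cycle))

      covers : ∀ y → ∃[ i ] Reach g (rep′ i) y
      covers y = i , by-cases (mergedCycleOf y Fin.≟ cycleOf a) (cycleOf y Fin.≟ cycleOf b)
        where
        i : Fin c
        i = Fin.punchOut (merged≢b (cycleOf y) ∘ sym)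
        punchIn-i : Fin.punchIn (cycleOf b) i ≡ mergedCycleOf y
        punchIn-i = FinP.punchIn-punchOut _
        by-cases : Dec (mergedCycleOf y ≡ cycleOf a) → Dec (cycleOf y ≡ cycleOf b) → Reach g (rep′ i) y
        by-cases (yes eq) (yes y-in-b) = subst (λ r → Reach g r y) (sym (rep′-a (trans punchIn-i eq)))
                                           (Reach-g-a (inj₂ y-in-b))
        by-cases (yes eq) (no y-not-b) = subst (λ r → Reach g r y) (sym (rep′-a (trans punchIn-i eq)))
                                           (Reach-g-a (inj₁ (trans (sym (merged-other y-not-b)) eq)))
        by-cases (no ne)  (yes y-in-b) = ⊥-elim (ne (trans (cong merged y-in-b) merged-b))
        by-cases (no ne)  (no y-not-b) = subst (λ r → Reach g r y)
            (sym (trans (rep′-other (ne ∘ trans (sym punchIn-i)))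
                        (cong rep (trans punchIn-i (merged-other y-not-b)))))
            (Reach-g-untouched (ne ∘ trans (merged-other y-not-b)) y-not-b)

      merge : CycleSystem g c
      merge = CycleSystem-fromClasses Class rep′ (λ {_} {x} eq → trans (mergedCycleOf-g x) eq)
        (λ {i} {j} eq eq′ → FinP.punchIn-injective (cycleOf b) i j (trans (sym eq) eq′))
        Class-rep′ covers

  CycleParity-transpose : ∀ {f p a b} → Bijective _≡_ _≡_ f → a ≢ b →
                          CycleParity f p → CycleParity (f ∘ transpose a b) (p ⁻¹)
  CycleParity-transpose {a = a} f-bij a≢b (zero , S , _) with () ← proj₁ (CycleSystem.rep-covers S a)
  CycleParity-transpose {f} {a = a} {b} f-bij a≢b (suc c , S , refl) = by-cases (cycleOf a Fin.≟ cycleOf b)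
    where
    open Transposed f-bij S a≢b using (cycleOf; module Split)
    open Merge f-bij S a≢b using (merge)
    by-cases : Dec (cycleOf a ≡ cycleOf b) → CycleParity (f ∘ transpose a b) (parity (suc c) ⁻¹)
    by-cases (yes same) = suc (suc c) , Split.split same , sym (⁻¹-selfInverse (suc-homo-⁻¹ (suc c)))
    by-cases (no diff)  = c , merge diff , sym (suc-homo-⁻¹ c)

module PairedInvolution {X : Set} (_≟_ : DecidableEquality X)
  {σ κ : X → X} (σ-involutive : ∀ x → σ (σ x) ≡ x) (κ-involutive : ∀ x → κ (κ x) ≡ x)
  (σκ-comm : ∀ x → σ (κ x) ≡ κ (σ x)) (κ≢id : ∀ x → κ x ≢ x) (κ≢σ : ∀ x → κ x ≢ σ x) where
  open Orbits {X}
  open Transpositions _≟_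

  power : (X → X) → Bool → X → X
  power h false = id
  power h true  = h

  power-xor : ∀ {h} → (∀ x → h (h x) ≡ x) → ∀ s t x → power h s (power h t x) ≡ power h (s xor t) x
  power-xor invol true  true  x = invol x
  power-xor invol true  false x = refl
  power-xor invol false t     x = refl

  power-comm : ∀ s t x → power σ s (power κ t x) ≡ power κ t (power σ s x)
  power-comm true  true  x = σκ-comm x
  power-comm true  false x = refl
  power-comm false t     x = refl

  act : Bool → Bool → X → X
  act s t = power σ s ∘ power κ t

  act-∘ : ∀ s t s′ t′ x → act s t (act s′ t′ x) ≡ act (s xor s′) (t xor t′) x
  act-∘ s t s′ t′ x = begin
    power σ s (power κ t (power σ s′ (power κ t′ x)))  ≡⟨ cong (power σ s) (power-comm s′ t _) ⟨
    power σ s (power σ s′ (power κ t (power κ t′ x)))  ≡⟨ power-xor {σ} σ-involutive s s′ _ ⟩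
    power σ (s xor s′) (power κ t (power κ t′ x))
      ≡⟨ cong (power σ (s xor s′)) (power-xor {κ} κ-involutive t t′ x) ⟩
    power σ (s xor s′) (power κ (t xor t′) x)          ∎
    where open ≡-Reasoning

  σ-act : ∀ s t x → σ (act s t x) ≡ act s t (σ x)
  σ-act s t x = begin
    act true false (act s t x)    ≡⟨ act-∘ true false s t x ⟩
    act (true xor s) t x          ≡⟨ cong₂ (λ s′ t′ → act s′ t′ x) (xor-comm true s) (sym (xor-identityʳ t)) ⟩
    act (s xor true) (t xor false) x ≡⟨ act-∘ s t true false x ⟨
    act s t (σ x)                 ∎
    where open ≡-Reasoning

  Block : X → X → Set
  Block z x = ∃[ s ] ∃[ t ] act s t z ≡ x

  block? : ∀ z x → Dec (Block z x)
  block? z x with act false false z ≟ x | act false true z ≟ x | act true false z ≟ x | act true true z ≟ x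
  ... | yes e | _     | _     | _     = yes (false , false , e)
  ... | _     | yes e | _     | _     = yes (false , true , e)
  ... | _     | _     | yes e | _     = yes (true , false , e)
  ... | _     | _     | _     | yes e = yes (true , true , e)
  ... | no n₀ | no n₁ | no n₂ | no n₃ = no λ
    { (false , false , e) → n₀ e ; (false , true , e) → n₁ e
    ; (true , false , e) → n₂ e  ; (true , true , e) → n₃ e }

  Block-sym : ∀ {z x} → Block z x → Block x z
  Block-sym {z} (s , t , refl) =
    s , t , trans (act-∘ s t s t z) (cong₂ (λ s′ t′ → act s′ t′ z) (xor-same s) (xor-same t))

  Block-trans : ∀ {z x y} → Block z x → Block x y → Block z y
  Block-trans {z} (s , t , refl) (s′ , t′ , refl) = s′ xor s , t′ xor t , sym (act-∘ s′ t′ s t z)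

  Block-σ : ∀ {z x} → Block z x → Block z (σ x)
  Block-σ blk = Block-trans blk (true , false , refl)

  σ-fixed-block : ∀ {z x} → σ z ≡ z → Block z x → σ x ≡ x
  σ-fixed-block {z} σz≡z (s , t , refl) = trans (σ-act s t z) (cong (act s t) σz≡z)

  module _ {z : X} (moved : σ z ≢ z) where
    -- The four points z, σ z, κ z, κ (σ z) are distinct, and σ swaps them in two pairs.
    doubleTranspose : X → X
    doubleTranspose = transpose z (σ z) ∘ transpose (κ z) (κ (σ z))

    z≢κz : z ≢ κ z
    z≢κz = κ≢id z ∘ sym

    z≢κσz : z ≢ κ (σ z)
    z≢κσz eq = κ≢σ (σ z) (trans (sym eq) (sym (σ-involutive z)))

    σz≢κz : σ z ≢ κ z
    σz≢κz = κ≢σ z ∘ sym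

    σz≢κσz : σ z ≢ κ (σ z)
    σz≢κσz = κ≢id (σ z) ∘ sym

    doubleTranspose-block : ∀ {x} → Block z x → doubleTranspose x ≡ σ x
    doubleTranspose-block (false , false , refl) =
      trans (cong (transpose z (σ z)) (transpose-other z≢κz z≢κσz)) (transpose-a z (σ z))
    doubleTranspose-block (true , false , refl) =
      trans (cong (transpose z (σ z)) (transpose-other σz≢κz σz≢κσz))
            (trans (transpose-b z (σ z)) (sym (σ-involutive z)))
    doubleTranspose-block (false , true , refl) =
      trans (cong (transpose z (σ z)) (transpose-a (κ z) (κ (σ z))))
            (trans (transpose-other (z≢κσz ∘ sym) (σz≢κσz ∘ sym)) (sym (σκ-comm z)))
    doubleTranspose-block (true , true , refl) = begin
      doubleTranspose (σ (κ z))    ≡⟨ cong doubleTranspose (σκ-comm z) ⟩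
      doubleTranspose (κ (σ z))    ≡⟨ cong (transpose z (σ z)) (transpose-b (κ z) (κ (σ z))) ⟩
      transpose z (σ z) (κ z)      ≡⟨ transpose-other (z≢κz ∘ sym) (σz≢κz ∘ sym) ⟩
      κ z                          ≡⟨ σ-involutive (κ z) ⟨
      σ (σ (κ z))                  ∎
      where open ≡-Reasoning

    doubleTranspose-outside : ∀ {x} → ¬ Block z x → doubleTranspose x ≡ x
    doubleTranspose-outside {x} ¬blk = trans
      (cong (transpose z (σ z)) (transpose-other (¬blk ∘ (λ eq → false , true , sym eq))
                                                 (¬blk ∘ (λ eq → true , true , trans (σκ-comm z) (sym eq)))))
      (transpose-other (¬blk ∘ (λ eq → false , false , sym eq)) (¬blk ∘ (λ eq → true , false , sym eq)))

  Covered : List X → X → Set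
  Covered L x = Any (λ z → Block z x) L

  covered? : ∀ L x → Dec (Covered L x)
  covered? L x = Any.any? (λ z → block? z x) L

  restrict : List X → X → X
  restrict L x with covered? L x
  ... | yes _ = σ x
  ... | no _  = x

  restrict-covered : ∀ {L x} → Covered L x → restrict L x ≡ σ x
  restrict-covered {L} {x} cov with covered? L x
  ... | yes _  = refl
  ... | no ¬cov = ⊥-elim (¬cov cov)

  restrict-uncovered : ∀ {L x} → ¬ Covered L x → restrict L x ≡ x
  restrict-uncovered {L} {x} ¬cov with covered? L x
  ... | yes cov = ⊥-elim (¬cov cov)
  ... | no _    = refl

  Covered-σ : ∀ {L x} → Covered L x → Covered L (σ x)
  Covered-σ = Any.map Block-σ

  restrict-involutive : ∀ L x → restrict L (restrict L x) ≡ x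
  restrict-involutive L x = by-cases (covered? L x)
    where
    by-cases : Dec (Covered L x) → restrict L (restrict L x) ≡ x
    by-cases (yes cov) = trans (cong (restrict L) (restrict-covered {L} cov))
                               (trans (restrict-covered {L} (Covered-σ cov)) (σ-involutive x))
    by-cases (no ¬cov) = trans (cong (restrict L) (restrict-uncovered {L} ¬cov)) (restrict-uncovered {L} ¬cov)

  restrict-∷-block : ∀ {z L x} → Block z x → restrict (z ∷ L) x ≡ σ x
  restrict-∷-block {z} {L} blk = restrict-covered {z ∷ L} (here blk)

  restrict-∷-outside : ∀ {z L x} → ¬ Block z x → restrict (z ∷ L) x ≡ restrict L x
  restrict-∷-outside {z} {L} {x} ¬blk = by-cases (covered? L x)
    where
    by-cases : Dec (Covered L x) → restrict (z ∷ L) x ≡ restrict L x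
    by-cases (yes cov) = trans (restrict-covered {z ∷ L} (there cov)) (sym (restrict-covered {L} cov))
    by-cases (no ¬cov) = trans (restrict-uncovered {z ∷ L} λ { (here blk) → ¬blk blk ; (there cov) → ¬cov cov })
                               (sym (restrict-uncovered {L} ¬cov))

  restrict-∷-covered : ∀ {z L} → Covered L z → ∀ x → restrict (z ∷ L) x ≡ restrict L x
  restrict-∷-covered {z} {L} cov-z x = by-cases (block? z x)
    where
    by-cases : Dec (Block z x) → restrict (z ∷ L) x ≡ restrict L x
    by-cases (yes blk) = trans (restrict-∷-block {L = L} blk)
                               (sym (restrict-covered {L} (Any.map (λ b → Block-trans b blk) cov-z)))
    by-cases (no ¬blk) = restrict-∷-outside {L = L} ¬blk

  restrict-∷-fixed : ∀ {z L} → σ z ≡ z → ∀ x → restrict (z ∷ L) x ≡ restrict L x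
  restrict-∷-fixed {z} {L} σz≡z x = by-cases (block? z x) (covered? L x)
    where
    by-cases : Dec (Block z x) → Dec (Covered L x) → restrict (z ∷ L) x ≡ restrict L x
    by-cases (yes blk) (yes cov) = trans (restrict-∷-block {L = L} blk) (sym (restrict-covered {L} cov))
    by-cases (yes blk) (no ¬cov) = trans (restrict-∷-block {L = L} blk)
                                         (trans (σ-fixed-block σz≡z blk) (sym (restrict-uncovered {L} ¬cov)))
    by-cases (no ¬blk) _         = restrict-∷-outside {L = L} ¬blk

  restrict-∷-moved : ∀ {z L} → ¬ Covered L z → (moved : σ z ≢ z) →
                     ∀ x → restrict (z ∷ L) x ≡ restrict L (doubleTranspose moved x)
  restrict-∷-moved {z} {L} ¬cov-z moved x = by-cases (block? z x)
    where
    open ≡-Reasoning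
    by-cases : Dec (Block z x) → restrict (z ∷ L) x ≡ restrict L (doubleTranspose moved x)
    by-cases (yes blk) = begin
      restrict (z ∷ L) x                   ≡⟨ restrict-∷-block {L = L} blk ⟩
      σ x                                  ≡⟨ restrict-uncovered {L} ¬cov-σx ⟨
      restrict L (σ x)                     ≡⟨ cong (restrict L) (doubleTranspose-block moved blk) ⟨
      restrict L (doubleTranspose moved x) ∎
      where
      ¬cov-σx : ¬ Covered L (σ x)
      ¬cov-σx cov = ¬cov-z (Any.map (λ b → Block-trans b (Block-sym (Block-σ blk))) cov)
    by-cases (no ¬blk) = trans (restrict-∷-outside {L = L} ¬blk)
                               (cong (restrict L) (sym (doubleTranspose-outside moved ¬blk)))

  -- Every new block on which σ moves points contributes two transpositions.
  CycleParity-restrict : ∀ {π p} → Bijective _≡_ _≡_ π → CycleParity π p →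
                         ∀ L → CycleParity (π ∘ restrict L) p
  CycleParity-restrict {π} π-bij P [] = CycleParity-≗ (λ x → cong π (sym (restrict-uncovered {[]} λ ()))) P
  CycleParity-restrict {π} {p} π-bij P (z ∷ L) = by-cases (covered? L z) (σ z ≟ z)
    where
    IH : CycleParity (π ∘ restrict L) p
    IH = CycleParity-restrict π-bij P L
    IH-bij : Bijective _≡_ _≡_ (π ∘ restrict L)
    IH-bij = ∘-bijective π-bij (involution⇒bijective (restrict-involutive L))
    by-cases : Dec (Covered L z) → Dec (σ z ≡ z) → CycleParity (π ∘ restrict (z ∷ L)) p
    by-cases (yes cov)  _            = CycleParity-≗ (λ x → cong π (sym (restrict-∷-covered cov x))) IH
    by-cases (no _)     (yes fixed)  = CycleParity-≗ (λ x → cong π (sym (restrict-∷-fixed fixed x))) IH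
    by-cases (no ¬cov)  (no moved)   =
      CycleParity-≗ (λ x → cong π (sym (restrict-∷-moved ¬cov moved x)))
        (subst (CycleParity _) (⁻¹-involutive p)
          (CycleParity-transpose
            (∘-bijective IH-bij (involution⇒bijective (transpose-involutive z (σ z))))
            (moved ∘ sym ∘ proj₁ (involution⇒bijective {κ} κ-involutive))
            (CycleParity-transpose IH-bij (moved ∘ sym) IH)))

  CycleParity-∘σ : ∀ {π p} (elements : List X) → (∀ x → x ∈ₗ elements) →
                   Bijective _≡_ _≡_ π → CycleParity π p → CycleParity (π ∘ σ) p
  CycleParity-∘σ {π} elements ∈-elements π-bij P = CycleParity-≗
    (λ x → cong π (restrict-covered {elements} (Any.map (λ { refl → false , false , refl }) (∈-elements x))))
    (CycleParity-restrict π-bij P elements)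

TransClosure-⊆ : ∀ {n} {R R′ : Fin n → Fin n → Set} → (∀ {i j} → R i j → R′ i j) →
                 ∀ {i j} → TransClosure R i j → TransClosure R′ i j
TransClosure-⊆ R⊆R′ [ r ]      = [ R⊆R′ r ]
TransClosure-⊆ R⊆R′ (r ∷ rs⁺) = R⊆R′ r ∷ TransClosure-⊆ R⊆R′ rs⁺

Acyclic-⊆ : ∀ {n} {R R′ : Fin n → Fin n → Set} → (∀ {i j} → R i j → R′ i j) → Acyclic R′ → Acyclic R
Acyclic-⊆ R⊆R′ acyclic i = acyclic i ∘ TransClosure-⊆ R⊆R′

Acyclic⇒¬infiniteWalk : ∀ {n} {R : Fin n → Fin n → Set} → Acyclic R →
                        (walk : ℕ → Fin n) → ¬ (∀ k → R (walk k) (walk (suc k)))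
Acyclic⇒¬infiniteWalk {n} {R} acyclic walk step
  with i , j , i<j , walkᵢ≡walkⱼ ← FinP.pigeonhole (n<1+n n) (walk ∘ Fin.toℕ) =
  acyclic (walk (Fin.toℕ i)) (subst (TransClosure R _) (sym walkᵢ≡walkⱼ)
    (subst (λ k → TransClosure R _ (walk k)) 1+d+i≡j (path (Fin.toℕ i) d)))
  where
  path : ∀ k d → TransClosure R (walk k) (walk (suc (d + k)))
  path k zero    = [ step k ]
  path k (suc d) = step k ∷ subst (λ m → TransClosure R (walk (suc k)) (walk m))
                                 (cong suc (+-suc d k)) (path (suc k) d)
  d = Fin.toℕ j ∸ suc (Fin.toℕ i)
  1+d+i≡j : suc (d + Fin.toℕ i) ≡ Fin.toℕ j
  1+d+i≡j = trans (sym (+-suc d (Fin.toℕ i))) (m∸n+n≡m i<j)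

Acyclic⇒sink : ∀ {n} {R : Fin n → Fin n → Set} → (∀ i j → Dec (R i j)) → Acyclic R →
               {P : Fin n → Set} → Decidable P → (∀ {i j} → R i j → P j) →
               ∀ {u₀} → P u₀ → ∃[ u ] P u × (∀ j → ¬ R u j)
Acyclic⇒sink {n} {R} R? acyclic {P} P? R⇒P {u₀} Pu₀
  with FinP.any? (λ u → P? u ×-dec FinP.all? (λ j → ¬? (R? u j)))
... | yes sink = sink
... | no ¬sink =
  ⊥-elim (Acyclic⇒¬infiniteWalk acyclic (proj₁ ∘ walk) (λ k → proj₂ (successor (proj₂ (walk k)))))
  where
  successor : ∀ {u} → P u → ∃[ j ] R u j
  successor {u} Pu with FinP.any? (R? u)
  ... | yes s = s
  ... | no ¬s = ⊥-elim (¬sink (u , Pu , λ j r → ¬s (j , r)))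
  walk : ℕ → Σ (Fin n) P
  walk zero    = u₀ , Pu₀
  walk (suc k) = let j , r = successor (proj₂ (walk k)) in j , R⇒P r

third-vertex : ∀ {m} {u v : Fin (suc (suc (suc m)))} → u ≢ v → ∃[ k ] k ≢ u × k ≢ v
third-vertex {u = u} {v} u≢v = Fin.punchIn u k′ , FinP.punchInᵢ≢i u k′ , k≢v
  where
  v′ = Fin.punchOut u≢v
  k′ = Fin.punchIn v′ zero
  k≢v : Fin.punchIn u k′ ≢ v
  k≢v eq = FinP.punchInᵢ≢i v′ zero (FinP.punchIn-injective u _ _ (trans eq (sym (FinP.punchIn-punchOut u≢v))))

open Orbits

flip : ∀ {n} → Fin n → Config n → Config n
flip i x = updateAt x i not

lookup-flip : ∀ {n} (i : Fin n) x → lookup (flip i x) i ≡ not (lookup x i)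
lookup-flip i x = lookup∘updateAt i x

lookup-flip-other : ∀ {n} {i j : Fin n} → j ≢ i → ∀ x → lookup (flip i x) j ≡ lookup x j
lookup-flip-other {i = i} {j} j≢i x = lookup∘updateAt′ j i j≢i x

lookup-ext : ∀ {n} {x y : Config n} → (∀ i → lookup x i ≡ lookup y i) → x ≡ y
lookup-ext {x = x} {y} eq = trans (sym (tabulate∘lookup x)) (trans (tabulate-cong eq) (tabulate∘lookup y))

flip-involutive : ∀ {n} (i : Fin n) x → flip i (flip i x) ≡ x
flip-involutive i x = trans (updateAt-updateAt i x) (updateAt-id-local i x (not-involutive _))

flip-changes : ∀ {n} (i : Fin n) {x y} → lookup y i ≡ lookup x i → flip i x ≢ y
flip-changes i {x} yᵢ≡xᵢ eq =
  not-¬ refl (sym (trans (sym (lookup-flip i x)) (trans (cong (λ z → lookup z i) eq) yᵢ≡xᵢ)))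

configurations : ∀ n → List (Config n)
configurations zero    = [] ∷ []
configurations (suc n) = List.map (false ∷_) (configurations n) ++ List.map (true ∷_) (configurations n)

∈-configurations : ∀ {n} (x : Config n) → x ∈ₗ configurations n
∈-configurations []          = here refl
∈-configurations (false ∷ x) = ∈-++⁺ˡ (∈-map⁺ (false ∷_) (∈-configurations x))
∈-configurations (true ∷ x)  =
  ∈-++⁺ʳ (List.map (false ∷_) (configurations _)) (∈-map⁺ (true ∷_) (∈-configurations x))

∃-configuration? : ∀ {n} {P : Config n → Set} → Decidable P → Dec (∃ P)
∃-configuration? {n} P? = Dec.map′ Any.satisfied (λ (x , Px) → lose (∈-configurations x) Px)
                                   (Any.any? P? (configurations n))

-- The pairs {x, σ x} are permuted by flipping k without fixed pairs, so σ is a product of disjoint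
-- double transpositions.
CycleParity-∘-coordinateFixing : ∀ {n} {σ : Config n → Config n} (k : Fin n) →
  (∀ x → σ (σ x) ≡ x) → (∀ x → lookup (σ x) k ≡ lookup x k) → (∀ x → σ (flip k x) ≡ flip k (σ x)) →
  ∀ {π p} → Bijective _≡_ _≡_ π → CycleParity π p → CycleParity (π ∘ σ) p
CycleParity-∘-coordinateFixing {n} k σ-involutive σ-fixes-k σ-flip =
  PairedInvolution.CycleParity-∘σ (≡-dec Bool._≟_) σ-involutive (flip-involutive k) σ-flip
    (λ x → flip-changes k refl) (λ x → flip-changes k (σ-fixes-k x))
    (configurations n) ∈-configurations

iter≗^ : ∀ {n} (F : AN n) k → iter F k ≗ (F ^ k)
iter≗^ F zero    x = refl
iter≗^ F (suc k) x = cong F (iter≗^ F k x)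

CycleRepresentatives⇒CycleSystem : ∀ {n} {F : AN n} {c rs} → CycleRepresentatives F c rs → CycleSystem F c
CycleRepresentatives⇒CycleSystem {F = F} {rs = rs} (covers , distinct) = record
  { rep          = rs
  ; rep-covers   = λ x → let i , k , eq = covers x in i , k , trans (sym (iter≗^ F k (rs i))) eq
  ; rep-distinct = λ {i} {j} (k , eq) → distinct i j k (trans (iter≗^ F k (rs i)) eq)
  }

module Network {n} (F : AN n) where
  Flips : Fin n → Fin n → Set
  Flips i j = ∃[ x ] lookup (F (flip i x)) j ≢ lookup (F x) j

  flips? : ∀ i j → Dec (Flips i j)
  flips? i j = ∃-configuration? (λ x → ¬? (lookup (F (flip i x)) j Bool.≟ lookup (F x) j))

  Flips⇒Arc : ∀ {i j} → Flips i j → Arc F i j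
  Flips⇒Arc {i} (x , changes) = flip i x , x , (λ k k≢i → lookup-flip-other k≢i x) , changes

  ¬Flips : ∀ {i j} → ¬ Flips i j → ∀ x → lookup (F (flip i x)) j ≡ lookup (F x) j
  ¬Flips ¬flips x = decidable-stable (_ Bool.≟ _) (λ changes → ¬flips (x , changes))

  Acyclic⇒sink-flip : ∀ {v} → Acyclic (ArcWithout F v) → ∀ {u₀} → u₀ ≢ v →
    ∃[ u ] u ≢ v × (∀ j → j ≢ v → ∀ x → lookup (F (flip u x)) j ≡ lookup (F x) j)
  Acyclic⇒sink-flip {v} acyclic u₀≢v
    with Acyclic⇒sink R? (Acyclic-⊆ R⊆Arc acyclic) (λ u → ¬? (u Fin.≟ v)) (proj₁ ∘ proj₂) u₀≢v
    where
    R : Fin n → Fin n → Set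
    R i j = i ≢ v × j ≢ v × Flips i j
    R? : ∀ i j → Dec (R i j)
    R? i j = ¬? (i Fin.≟ v) ×-dec ¬? (j Fin.≟ v) ×-dec flips? i j
    R⊆Arc : ∀ {i j} → R i j → ArcWithout F v i j
    R⊆Arc (i≢v , j≢v , flips) = i≢v , j≢v , Flips⇒Arc flips
  ... | u , u≢v , sink = u , u≢v , λ j j≢v → ¬Flips (λ flips → sink j (u≢v , j≢v , flips))

  DegreeAtMost⇒independent : ∀ {d} → d < n → DegreeAtMost d F →
    ∀ v → ∃[ w ] ∀ x → lookup (F (flip w x)) v ≡ lookup (F x) v
  DegreeAtMost⇒independent d<n degree v with FinP.any? (λ w → ¬? (flips? w v))
  ... | yes (w , ¬flips) = w , ¬Flips ¬flips
  ... | no none = ⊥-elim (<⇒≱ d<n (subst (_≤ _) (∣⊤∣≡n n) (degree v ⊤ λ i _ → Flips⇒Arc (all-flip i))))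
    where
    all-flip : ∀ i → Flips i v
    all-flip i = decidable-stable (flips? i v) (λ ¬flips → none (i , ¬flips))

module Decomposition {n} {F : AN n} (F-bij : Bijective _≡_ _≡_ F) {u v : Fin n} (u≢v : u ≢ v)
  (u-sink : ∀ j → j ≢ v → ∀ x → lookup (F (flip u x)) j ≡ lookup (F x) j) where
  open Transpositions {Fin n} Fin._≟_
    using (transpose; transpose-a; transpose-b; transpose-other; transpose-involutive)

  centre : Config n → Bool
  centre x = lookup (F x) v

  centre-flip-u : ∀ x → centre (flip u x) ≡ not (centre x)
  centre-flip-u x = ¬-not λ eq → flip-changes u refl (proj₁ F-bij (lookup-ext λ j → by-cases eq (j Fin.≟ v)))
    where
    by-cases : ∀ {j} → centre (flip u x) ≡ centre x → Dec (j ≡ v) → lookup (F (flip u x)) j ≡ lookup (F x) j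
    by-cases eq (yes refl) = eq
    by-cases eq (no j≢v)   = u-sink _ j≢v x

  T : Config n → Config n
  T x = x [ u ]≔ centre x

  T-cases : ∀ x → (centre x ≡ lookup x u × T x ≡ x) ⊎ (centre x ≡ not (lookup x u) × T x ≡ flip u x)
  T-cases x with centre x Bool.≟ lookup x u
  ... | yes eq = inj₁ (eq , updateAt-id-local u x eq)
  ... | no ne  = inj₂ (¬-not ne , updateAt-cong-local u x (¬-not ne))

  F-T-other : ∀ {j} → j ≢ v → ∀ x → lookup (F (T x)) j ≡ lookup (F x) j
  F-T-other j≢v x with T-cases x
  ... | inj₁ (_ , Tx≡x)      = cong (λ y → lookup (F y) _) Tx≡x
  ... | inj₂ (_ , Tx≡flipx)  = trans (cong (λ y → lookup (F y) _) Tx≡flipx) (u-sink _ j≢v x)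

  centre-T : ∀ x → centre (T x) ≡ lookup x u
  centre-T x with T-cases x
  ... | inj₁ (eq , Tx≡x)     = trans (cong centre Tx≡x) eq
  ... | inj₂ (eq , Tx≡flipx) = trans (cong centre Tx≡flipx)
                                 (trans (centre-flip-u x) (trans (cong not eq) (not-involutive _)))

  T-involutive : ∀ x → T (T x) ≡ x
  T-involutive x = trans (cong (T x [ u ]≔_) (centre-T x))
                         (trans (updateAt-updateAt u x) (updateAt-id-local u x refl))

  module _ {w} (w-free : ∀ x → lookup (F (flip w x)) v ≡ lookup (F x) v) where
    w≢u : w ≢ u
    w≢u refl = not-¬ refl (trans (sym (w-free _)) (centre-flip-u (Vec.replicate n false)))

    T-fixes-w : ∀ x → lookup (T x) w ≡ lookup x w
    T-fixes-w x = lookup∘update′ w≢u x _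

    T-flip-w : ∀ x → T (flip w x) ≡ flip w (T x)
    T-flip-w x = trans (cong (flip w x [ u ]≔_) (w-free x)) (updateAt-commutes u w (w≢u ∘ sym) x)

  S : Config n → Config n
  S x = tabulate (lookup x ∘ transpose u v)

  lookup-S : ∀ x l → lookup (S x) l ≡ lookup x (transpose u v l)
  lookup-S x = lookup∘tabulate (lookup x ∘ transpose u v)

  S-involutive : ∀ x → S (S x) ≡ x
  S-involutive x = lookup-ext λ l →
    trans (lookup-S (S x) l) (trans (lookup-S x _) (cong (lookup x) (transpose-involutive u v l)))

  module _ {k} (k≢u : k ≢ u) (k≢v : k ≢ v) where
    S-fixes-k : ∀ x → lookup (S x) k ≡ lookup x k
    S-fixes-k x = trans (lookup-S x k) (cong (lookup x) (transpose-other k≢u k≢v))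

    S-flip-k : ∀ x → S (flip k x) ≡ flip k (S x)
    S-flip-k x = lookup-ext λ l → by-cases (l Fin.≟ k)
      where
      by-cases : ∀ {l} → Dec (l ≡ k) → lookup (S (flip k x)) l ≡ lookup (flip k (S x)) l
      by-cases (yes refl) = begin
        lookup (S (flip k x)) k  ≡⟨ S-fixes-k (flip k x) ⟩
        lookup (flip k x) k      ≡⟨ lookup-flip k x ⟩
        not (lookup x k)         ≡⟨ cong not (S-fixes-k x) ⟨
        not (lookup (S x) k)     ≡⟨ lookup-flip k (S x) ⟨
        lookup (flip k (S x)) k  ∎
        where open ≡-Reasoning
      by-cases {l} (no l≢k) = trans (lookup-S (flip k x) l) (trans (lookup-flip-other τl≢k x)
                                (sym (trans (lookup-flip-other l≢k (S x)) (lookup-S x l))))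
        where
        τl≢k : transpose u v l ≢ k
        τl≢k eq = l≢k (trans (sym (transpose-involutive u v l))
                        (trans (cong (transpose u v) eq) (transpose-other k≢u k≢v)))

  H : Config n → Config n
  H = S ∘ F ∘ T

  H-fixes-u : ∀ x → lookup (H x) u ≡ lookup x u
  H-fixes-u x = trans (lookup-S (F (T x)) u) (trans (cong (lookup (F (T x))) (transpose-a u v)) (centre-T x))

  H-flip-u : ∀ x → H (flip u x) ≡ flip u (H x)
  H-flip-u x = lookup-ext λ l → by-cases (l Fin.≟ u)
    where
    by-cases : ∀ {l} → Dec (l ≡ u) → lookup (H (flip u x)) l ≡ lookup (flip u (H x)) l
    by-cases (yes refl) = trans (H-fixes-u (flip u x)) (trans (lookup-flip u x)
                            (sym (trans (lookup-flip u (H x)) (cong not (H-fixes-u x)))))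
    by-cases {l} (no l≢u) = begin
      lookup (H (flip u x)) l                 ≡⟨ lookup-S (F (T (flip u x))) l ⟩
      lookup (F (T (flip u x))) (τ l)         ≡⟨ F-T-other τl≢v (flip u x) ⟩
      lookup (F (flip u x)) (τ l)             ≡⟨ u-sink _ τl≢v x ⟩
      lookup (F x) (τ l)                      ≡⟨ F-T-other τl≢v x ⟨
      lookup (F (T x)) (τ l)                  ≡⟨ lookup-S (F (T x)) l ⟨
      lookup (H x) l                          ≡⟨ lookup-flip-other l≢u (H x) ⟨
      lookup (flip u (H x)) l                 ∎
      where
      open ≡-Reasoning
      τ = transpose u v
      τl≢v : τ l ≢ v
      τl≢v eq = l≢u (trans (sym (transpose-involutive u v l)) (trans (cong τ eq) (transpose-b u v)))

  F≗S∘H∘T : ∀ x → F x ≡ S (H (T x))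
  F≗S∘H∘T x = sym (trans (S-involutive _) (cong F (T-involutive x)))

  T-bijective : Bijective _≡_ _≡_ T
  T-bijective = involution⇒bijective T-involutive

  S-bijective : Bijective _≡_ _≡_ S
  S-bijective = involution⇒bijective S-involutive

  H-bijective : Bijective _≡_ _≡_ H
  H-bijective = ∘-bijective S-bijective (∘-bijective F-bij T-bijective)

  CycleParity-F⇒H : ∀ {w} → (∀ x → lookup (F (flip w x)) v ≡ lookup (F x) v) →
                    ∀ {k} → k ≢ u → k ≢ v → ∀ {p} → CycleParity F p → CycleParity H p
  CycleParity-F⇒H w-free k≢u k≢v F-parity =
    CycleParity-≗ (cong H ∘ S-involutive)
      (CycleParity-∘-coordinateFixing _ S-involutive (S-fixes-k k≢u k≢v) (S-flip-k k≢u k≢v)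
         (∘-bijective H-bijective S-bijective) (CycleParity-rotate H-bijective S∘H-parity))
    where
    S∘H-parity : CycleParity (S ∘ H) _
    S∘H-parity = CycleParity-≗ (cong (S ∘ H) ∘ T-involutive)
      (CycleParity-∘-coordinateFixing _ T-involutive (T-fixes-w w-free) (T-flip-w w-free)
         (∘-bijective S-bijective (∘-bijective H-bijective T-bijective)) (CycleParity-≗ F≗S∘H∘T F-parity))

  CycleSystem-even-F : ∀ {w} → (∀ x → lookup (F (flip w x)) v ≡ lookup (F x) v) →
                       ∀ {k} → k ≢ u → k ≢ v → ∀ {c} → CycleSystem F c → parity c ≡ 0ℙ
  CycleSystem-even-F w-free k≢u k≢v {c} system
    with c′ , H-system , c′≡c ← CycleParity-F⇒H w-free k≢u k≢v (c , system , refl) =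
    trans (sym c′≡c) (CycleSystem-even (proj₂ H-bijective) (flip-involutive u) H-flip-u
                                       (λ x → lookup x u) H-fixes-u (lookup-flip u) H-system)

theorem5 : ∀ (n d : ℕ) → 3 ≤ n → d < n → (F : AN n) →
    Bijective _≡_ _≡_ F → DegreeAtMost d F → Centralized F →
    ∀ (c : ℕ) → NumLimitCycles F c → 2 ∣ c
theorem5 n d (s≤s (s≤s (s≤s _))) d<n F F-bij degree (v , acyclic) c (_ , representatives)
  with u , u≢v , u-sink ← Network.Acyclic⇒sink-flip F acyclic (FinP.punchInᵢ≢i v zero)
  with w , w-free ← Network.DegreeAtMost⇒independent F d<n degree v
  with k , k≢u , k≢v ← third-vertex u≢v
  = parity≡0ℙ⇒2∣ c (Decomposition.CycleSystem-even-F F-bij u≢v u-sink w-free k≢u k≢v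
                      (CycleRepresentatives⇒CycleSystem representatives))
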